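{- Let $\Gamma$ and $\Gamma'$ be two $1$-walk-regular graphs. Then the Kronecker product $\Gamma\otimes\Gamma'$ is $1$-walk-regular.
   Context: All graphs are finite and simple. A graph is $1$-walk-regular if it has at least one edge and for every $\ell\geq0$ the number of walks of length $\ell$ between vertices $x$ and $y$ depends only on $\mathrm{dist}(x,y)$ whenever $\mathrm{dist}(x,y)\leq 1$ (that is, the number of closed walks of length $\ell$ from $x$ to $x$ is the same for all vertices $x$, and the number of walks of length $\ell$ from $x$ to $y$ is the same for all adjacent pairs $x,y$). If $A$ and $B$ are the adjacency matrices of $\Gamma$ and $\Gamma'$, the Kronecker product $\Gamma\otimes\Gamma'$ is the graph with adjacency matrix $A\otimes B$ (vertex set $V(\Gamma)\times V(\Gamma')$, $(x,x')\sim(y,y')$ iff $x\sim y$ and $x'\sim y'$). -}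

module Defs where

open import Data.Nat using (ℕ; zero; suc; _+_; _*_)
open import Data.Bool using (Bool; true; false; _∧_)
open import Data.Fin using (Fin; zero; suc; remQuot)
open import Data.Fin.Properties using (_≟_)
open import Data.Product using (Σ; _×_; _,_; proj₁; proj₂; ∃-syntax)
open import Data.Sum using (_⊎_)
open import Relation.Binary.PropositionalEquality using (_≡_)
open import Relation.Nullary using (¬_; yes; no)

record Graph (n : ℕ) : Set where
  field
    adj   : Fin n → Fin n → Bool
    sym   : ∀ x y → adj x y ≡ adj y x
    irrefl : ∀ x → adj x x ≡ false
open Graph public

_∼[_]_ : ∀ {n} → Fin n → Graph n → Fin n → Set
x ∼[ G ] y = adj G x y ≡ true

b2n : Bool → ℕ
b2n true  = 1
b2n false = 0

∑ : ∀ n → (Fin n → ℕ) → ℕ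
∑ zero    f = 0
∑ (suc n) f = f zero + ∑ n (λ i → f (suc i))

δ : ∀ {n} → Fin n → Fin n → ℕ
δ x y with x ≟ y
... | yes _ = 1
... | no  _ = 0

walks : ∀ {n} → ℕ → Graph n → Fin n → Fin n → ℕ
walks zero    G x y = δ x y
walks {n} (suc ℓ) G x y = ∑ n (λ z → b2n (adj G x z) * walks ℓ G z y)

-- G is 1-walk-regular: it has at least one edge, and for every ℓ the
-- number of walks of length ℓ between x and y depends only on dist(x,y)
-- whenever dist(x,y) ≤ 1 (i.e. x = y, or x ∼ y).
OneWalkRegular : ∀ {n} → Graph n → Set
OneWalkRegular {n} G =
  (∃[ x ] ∃[ y ] x ∼[ G ] y)
  × (∀ (ℓ : ℕ) (x x' : Fin n) → walks ℓ G x x ≡ walks ℓ G x' x')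
  × (∀ (ℓ : ℕ) (x y x' y' : Fin n) → x ∼[ G ] y → x' ∼[ G ] y'
       → walks ℓ G x y ≡ walks ℓ G x' y')

-- Kronecker product: vertex set Fin (n * m) ≅ Fin n × Fin m (via remQuot),
-- (x,x') ∼ (y,y') iff x ∼ y and x' ∼ y'.
kron-adj : ∀ {n m} → Graph n → Graph m → Fin (n * m) → Fin (n * m) → Bool
kron-adj {n} {m} G H i j =
  adj G (proj₁ (remQuot {n} m i)) (proj₁ (remQuot {n} m j))
  ∧ adj H (proj₂ (remQuot {n} m i)) (proj₂ (remQuot {n} m j))

open import Relation.Binary.PropositionalEquality using (cong₂; refl)

kron-sym : ∀ {n m} (G : Graph n) (H : Graph m) i j → kron-adj G H i j ≡ kron-adj G H j i
kron-sym {n} {m} G H i j =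
  cong₂ _∧_ (sym G (proj₁ (remQuot {n} m i)) (proj₁ (remQuot {n} m j)))
            (sym H (proj₂ (remQuot {n} m i)) (proj₂ (remQuot {n} m j)))

kron-irrefl : ∀ {n m} (G : Graph n) (H : Graph m) i → kron-adj G H i i ≡ false
kron-irrefl {n} {m} G H i rewrite irrefl G (proj₁ (remQuot {n} m i)) = refl

_⊗_ : ∀ {n m} → Graph n → Graph m → Graph (n * m)
G ⊗ H = record { adj = kron-adj G H ; sym = kron-sym G H ; irrefl = kron-irrefl G H }

module Submission where

open import Defs hiding (sym)
open import Data.Nat using (ℕ; zero; suc; _+_; _*_)
open import Data.Nat.Properties
  using (+-assoc; +-identityʳ; *-zeroʳ; *-distribˡ-+; *-distribʳ-+; [m*n]*[o*p]≡[m*o]*[n*p])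
open import Data.Bool using (Bool; true; false; _∧_)
open import Data.Bool.Properties using (∧-conicalˡ; ∧-conicalʳ)
open import Data.Fin using (Fin; zero; suc; remQuot; combine; _↑ˡ_; _↑ʳ_)
open import Data.Fin.Properties using (_≟_; remQuot-combine; combine-remQuot; combine-injective)
open import Data.Product using (_×_; _,_; proj₁; proj₂)
open import Relation.Binary.PropositionalEquality
  using (_≡_; _≢_; refl; sym; trans; cong; cong₂; module ≡-Reasoning)
open import Relation.Nullary using (yes; no; contradiction)

-- The adjacency matrix of Γ ⊗ Γ' is A ⊗ B, so its ℓ-th power is A^ℓ ⊗ B^ℓ: the number of
-- walks of length ℓ from (x,x') to (y,y') is the product of the walk counts in the factors.
-- Moreover an edge of Γ ⊗ Γ' projects to an edge in each factor, so on the diagonal and on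
-- the edges of Γ ⊗ Γ' both factors, hence their product, are independent of the pair.

∑-cong : ∀ n {f g : Fin n → ℕ} → (∀ i → f i ≡ g i) → ∑ n f ≡ ∑ n g
∑-cong zero    f≗g = refl
∑-cong (suc n) f≗g = cong₂ _+_ (f≗g zero) (∑-cong n (λ i → f≗g (suc i)))

∑-+ : ∀ a b (f : Fin (a + b) → ℕ) →
      ∑ (a + b) f ≡ ∑ a (λ i → f (i ↑ˡ b)) + ∑ b (λ i → f (a ↑ʳ i))
∑-+ zero    b f = refl
∑-+ (suc a) b f = trans (cong (f zero +_) (∑-+ a b (λ i → f (suc i))))
                        (sym (+-assoc (f zero) _ _))

∑-combine : ∀ n m (f : Fin (n * m) → ℕ) →
            ∑ (n * m) f ≡ ∑ n (λ x → ∑ m (λ y → f (combine x y)))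
∑-combine zero    m f = refl
∑-combine (suc n) m f = trans (∑-+ m (n * m) f)
  (cong (∑ m (λ i → f (i ↑ˡ (n * m))) +_) (∑-combine n m (λ i → f (m ↑ʳ i))))

*-∑ : ∀ n c (f : Fin n → ℕ) → c * ∑ n f ≡ ∑ n (λ i → c * f i)
*-∑ zero    c f = *-zeroʳ c
*-∑ (suc n) c f = trans (*-distribˡ-+ c (f zero) _) (cong (c * f zero +_) (*-∑ n c (λ i → f (suc i))))

∑-* : ∀ n c (f : Fin n → ℕ) → ∑ n f * c ≡ ∑ n (λ i → f i * c)
∑-* zero    c f = refl
∑-* (suc n) c f = trans (*-distribʳ-+ c (f zero) _) (cong (f zero * c +_) (∑-* n c (λ i → f (suc i))))

∑-*-∑ : ∀ n m (f : Fin n → ℕ) (g : Fin m → ℕ) →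
        ∑ n f * ∑ m g ≡ ∑ n (λ x → ∑ m (λ y → f x * g y))
∑-*-∑ n m f g = trans (∑-* n (∑ m g) f) (∑-cong n (λ x → *-∑ m (f x) g))

b2n-∧ : ∀ p q → b2n (p ∧ q) ≡ b2n p * b2n q
b2n-∧ true  q = sym (+-identityʳ (b2n q))
b2n-∧ false q = refl

δ-refl : ∀ {n} (x : Fin n) → δ x x ≡ 1
δ-refl x with x ≟ x
... | yes _  = refl
... | no x≢x = contradiction refl x≢x

δ-≢ : ∀ {n} {x y : Fin n} → x ≢ y → δ x y ≡ 0
δ-≢ {x = x} {y} x≢y with x ≟ y
... | yes x≡y = contradiction x≡y x≢y
... | no _    = refl

module _ {n m : ℕ} (G : Graph n) (H : Graph m) where

  adj-⊗-combine : ∀ x x' y y' → adj (G ⊗ H) (combine x x') (combine y y') ≡ (adj G x y ∧ adj H x' y')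
  adj-⊗-combine x x' y y' =
    cong₂ (λ (p q : Fin n × Fin m) → adj G (proj₁ p) (proj₁ q) ∧ adj H (proj₂ p) (proj₂ q))
          (remQuot-combine {n} {m} x x') (remQuot-combine {n} {m} y y')

  δ-combine : ∀ (x y : Fin n) (x' y' : Fin m) → δ (combine x x') (combine y y') ≡ δ x y * δ x' y'
  δ-combine x y x' y' with x ≟ y | x' ≟ y'
  ... | yes refl | yes refl = δ-refl (combine x x')
  ... | no x≢y   | _        = δ-≢ (λ eq → x≢y (proj₁ (combine-injective x x' y y' eq)))
  ... | yes _    | no x'≢y' = δ-≢ (λ eq → x'≢y' (proj₂ (combine-injective x x' y y' eq)))

  walks-⊗-combine : ∀ ℓ x x' y y' →
    walks ℓ (G ⊗ H) (combine x x') (combine y y') ≡ walks ℓ G x y * walks ℓ H x' y'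
  walks-⊗-combine zero    x x' y y' = δ-combine x y x' y'
  walks-⊗-combine (suc ℓ) x x' y y' = begin
    ∑ (n * m) (λ k → b2n (adj (G ⊗ H) (combine x x') k) * walks ℓ (G ⊗ H) k (combine y y'))
      ≡⟨ ∑-combine n m _ ⟩
    ∑ n (λ z → ∑ m (λ z' → b2n (adj (G ⊗ H) (combine x x') (combine z z'))
                           * walks ℓ (G ⊗ H) (combine z z') (combine y y')))
      ≡⟨ ∑-cong n (λ z → ∑-cong m (λ z' → step-factors z z')) ⟩
    ∑ n (λ z → ∑ m (λ z' → (b2n (adj G x z) * walks ℓ G z y) * (b2n (adj H x' z') * walks ℓ H z' y')))
      ≡⟨ sym (∑-*-∑ n m _ _) ⟩
    walks (suc ℓ) G x y * walks (suc ℓ) H x' y' ∎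
    where
    open ≡-Reasoning
    step-factors : ∀ z z' →
      b2n (adj (G ⊗ H) (combine x x') (combine z z')) * walks ℓ (G ⊗ H) (combine z z') (combine y y')
      ≡ (b2n (adj G x z) * walks ℓ G z y) * (b2n (adj H x' z') * walks ℓ H z' y')
    step-factors z z' = begin
      b2n (adj (G ⊗ H) (combine x x') (combine z z')) * walks ℓ (G ⊗ H) (combine z z') (combine y y')
        ≡⟨ cong₂ _*_ (cong b2n (adj-⊗-combine x x' z z')) (walks-⊗-combine ℓ z z' y y') ⟩
      b2n (adj G x z ∧ adj H x' z') * (walks ℓ G z y * walks ℓ H z' y')
        ≡⟨ cong (_* _) (b2n-∧ (adj G x z) (adj H x' z')) ⟩
      (b2n (adj G x z) * b2n (adj H x' z')) * (walks ℓ G z y * walks ℓ H z' y')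
        ≡⟨ [m*n]*[o*p]≡[m*o]*[n*p] (b2n (adj G x z)) _ _ _ ⟩
      (b2n (adj G x z) * walks ℓ G z y) * (b2n (adj H x' z') * walks ℓ H z' y') ∎

  π₁ : Fin (n * m) → Fin n
  π₁ i = proj₁ (remQuot {n} m i)

  π₂ : Fin (n * m) → Fin m
  π₂ i = proj₂ (remQuot {n} m i)

  walks-⊗ : ∀ ℓ i j → walks ℓ (G ⊗ H) i j ≡ walks ℓ G (π₁ i) (π₁ j) * walks ℓ H (π₂ i) (π₂ j)
  walks-⊗ ℓ i j =
    trans (cong₂ (walks ℓ (G ⊗ H)) (sym (combine-remQuot {n} m i)) (sym (combine-remQuot {n} m j)))
          (walks-⊗-combine ℓ (π₁ i) (π₂ i) (π₁ j) (π₂ j))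

  walks-⊗-cong : ∀ ℓ i j i' j'
    → walks ℓ G (π₁ i) (π₁ j) ≡ walks ℓ G (π₁ i') (π₁ j')
    → walks ℓ H (π₂ i) (π₂ j) ≡ walks ℓ H (π₂ i') (π₂ j')
    → walks ℓ (G ⊗ H) i j ≡ walks ℓ (G ⊗ H) i' j'
  walks-⊗-cong ℓ i j i' j' eqG eqH = begin
    walks ℓ (G ⊗ H) i j                                       ≡⟨ walks-⊗ ℓ i j ⟩
    walks ℓ G (π₁ i) (π₁ j) * walks ℓ H (π₂ i) (π₂ j)         ≡⟨ cong₂ _*_ eqG eqH ⟩
    walks ℓ G (π₁ i') (π₁ j') * walks ℓ H (π₂ i') (π₂ j')     ≡⟨ sym (walks-⊗ ℓ i' j') ⟩
    walks ℓ (G ⊗ H) i' j'                                     ∎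
    where open ≡-Reasoning

  ∼-⊗-combine : ∀ {x y x' y'} → x ∼[ G ] y → x' ∼[ H ] y' → combine x x' ∼[ G ⊗ H ] combine y y'
  ∼-⊗-combine {x} {y} {x'} {y'} x∼y x'∼y' = trans (adj-⊗-combine x x' y y') (cong₂ _∧_ x∼y x'∼y')

  ∼-⊗-projections : ∀ {i j} → i ∼[ G ⊗ H ] j → (π₁ i ∼[ G ] π₁ j) × (π₂ i ∼[ H ] π₂ j)
  ∼-⊗-projections {i} {j} i∼j = ∧-conicalˡ _ _ i∼j , ∧-conicalʳ (adj G (π₁ i) (π₁ j)) _ i∼j

proposition3p5 : ∀ {n m : ℕ} (Γ : Graph n) (Γ' : Graph m)
    → OneWalkRegular Γ → OneWalkRegular Γ' → OneWalkRegular (Γ ⊗ Γ')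
proposition3p5 Γ Γ' ((x , y , x∼y) , closed , along-edge) ((x' , y' , x'∼y') , closed' , along-edge') =
  (combine x x' , combine y y' , ∼-⊗-combine Γ Γ' x∼y x'∼y') ,
  (λ ℓ i j → walks-⊗-cong Γ Γ' ℓ i i j j (closed ℓ _ _) (closed' ℓ _ _)) ,
  (λ ℓ i j i' j' i∼j i'∼j' →
     let i∼j₁ , i∼j₂ = ∼-⊗-projections Γ Γ' i∼j
         i'∼j'₁ , i'∼j'₂ = ∼-⊗-projections Γ Γ' i'∼j'
     in walks-⊗-cong Γ Γ' ℓ i j i' j' (along-edge ℓ _ _ _ _ i∼j₁ i'∼j'₁) (along-edge' ℓ _ _ _ _ i∼j₂ i'∼j'₂))
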